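{- Let $m\ge1$, let $P$ be an $m$-Dyck path and let $Q=Q_1\times_0\cdots\times_0Q_r$ be an $m$-Dyck path with $Q_1,\dots,Q_r$ prime. For two weak compositions $\underline\lambda=(\lambda_0,\dots,\lambda_r)$ and $\underline\gamma=(\gamma_0,\dots,\gamma_r)$ of $L(P)$ of length $r+1$, we have $\lambda_j+\dots+\lambda_r\le\gamma_j+\dots+\gamma_r$ for all $1\le j\le r$ if and only if $P*_{\underline\lambda}Q\le P*_{\underline\gamma}Q$ in the $m$-Tamari order.
   Context: An $m$-Dyck path of size $n\ge1$ is a lattice path from $(0,0)$ to $(2nm,0)$ with $n$ up steps $(m,m)$ and $nm$ down steps $(1,-1)$ never going below the $x$-axis. Up steps are ranked $1,\dots,n$ left to right; a down step is at level $k$ if the last up step before it has rank $k$; $L(P)$ is the number of down steps of $P$ at level $n$ (the last $L(P)$ steps). For $0\le j\le L(P)$, $P\times_jQ$ is obtained by deleting the last $j$ down steps of $P$, appending a translate of $Q$, and then appending $j$ down steps. $P$ is prime if not of the form $A\times_0B$ with $A,B$ of smaller positive sizes. For a weak composition $\underline\lambda=(\lambda_0,\dots,\lambda_r)$ of $L(P)$ (nonnegative integers summing to $L(P)$) and $Q=Q_1\times_0\cdots\times_0Q_r$ with $Q_j$ prime, $P*_{\underline\lambda}Q:=((\cdots(P\times_{\lambda_1+\dots+\lambda_r}Q_1)\times_{\lambda_2+\dots+\lambda_r}Q_2\cdots)\times_{\lambda_r}Q_r)$. $m$-Tamari order on paths of a given size: for an up step $u$, its excursion is the shortest subpath of $P$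 starting with $u$ and ending at the height where $u$ starts. If a down step $d$ of $P$ is immediately followed by an up step $u$, write $P=A\,d\,E\,B$ with $E$ the excursion of $u$, and set $P_{(d)}:=A\,E\,d\,B$. The $m$-Tamari order is the partial order generated (reflexively and transitively) by $P\le P_{(d)}$ for all such $d$. -}

module Defs where

open import Data.Nat using (ℕ; zero; suc; _+_; _∸_; _≤_)
open import Data.List using (List; []; _∷_; _++_; length; take; replicate; reverse)
open import Data.Vec using (Vec; []; _∷_; sum)
open import Data.Product using (Σ; ∃; _×_; _,_)
open import Relation.Nullary using (¬_)
open import Relation.Binary.PropositionalEquality using (_≡_)
open import Relation.Binary.Construct.Closure.ReflexiveTransitive using (Star)

-- Steps of an m-Dyck path: U = up step (m,m), D = down step (1,-1).
data Step : Set where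
  U D : Step

Path : Set
Path = List Step

data Walk (m : ℕ) : ℕ → Path → Set where
  w-end : Walk m 0 []
  w-U   : ∀ {k xs} → Walk m (k + m) xs → Walk m k (U ∷ xs)
  w-D   : ∀ {k xs} → Walk m k xs → Walk m (suc k) (D ∷ xs)

size : Path → ℕ
size []       = 0
size (U ∷ xs) = suc (size xs)
size (D ∷ xs) = size xs

IsDyck : ℕ → Path → Set
IsDyck m P = Walk m 0 P × (1 ≤ size P)

leadingD : Path → ℕ
leadingD (D ∷ xs) = suc (leadingD xs)
leadingD _        = 0

L : Path → ℕ
L P = leadingD (reverse P)

-- P ×_j Q : delete the last j (down) steps of P, append Q, append j down steps.
-- (Used only for j ≤ L(P), where the last j steps are down steps.)
_×[_]_ : Path → ℕ → Path → Path
P ×[ j ] Q = take (length P ∸ j) P ++ Q ++ replicate j D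

IsPrime : ℕ → Path → Set
IsPrime m P = IsDyck m P ×
  ¬ (Σ Path λ A → Σ Path λ B → IsDyck m A × IsDyck m B × (P ≡ A ×[ 0 ] B))

tailSums : ∀ {n} → Vec ℕ n → Vec ℕ n
tailSums []       = []
tailSums (x ∷ xs) = (x + sum xs) ∷ tailSums xs

starAux : ∀ {k} → Path → Vec ℕ k → Vec Path k → Path
starAux acc []       []       = acc
starAux acc (s ∷ ss) (q ∷ qs) = starAux (acc ×[ s ] q) ss qs

-- P *_λ Q for λ = (λ₀, λ₁, …, λ_r) and Q = Q₁ ×₀ ⋯ ×₀ Q_r (given by its factors)
star : ∀ {r} → Path → Vec ℕ (suc r) → Vec Path r → Path
star P (_ ∷ λs) Qs = starAux P (tailSums λs) Qs

-- Excursion remainder: from height k, reach height 0 for the first time exactly at the end.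
data Ret (m : ℕ) : ℕ → Path → Set where
  ret-end : Ret m 0 []
  ret-D   : ∀ {k xs} → Ret m k xs → Ret m (suc k) (D ∷ xs)
  ret-U   : ∀ {k xs} → Ret m (suc k + m) xs → Ret m (suc k) (U ∷ xs)

IsExcursion : ℕ → Path → Set
IsExcursion m E = Σ Path λ xs → (E ≡ U ∷ xs) × Ret m m xs

data TamariStep (m : ℕ) : Path → Path → Set where
  move : ∀ A E B → IsExcursion m E →
         TamariStep m (A ++ D ∷ E ++ B) (A ++ E ++ D ∷ B)

_≤T[_]_ : Path → ℕ → Path → Set
P ≤T[ m ] P' = Star (TamariStep m) P P'

-- Write P = P' D^L with L = L(P), tᵢ = λᵢ + ⋯ + λ_r and sᵢ = γᵢ + ⋯ + γ_r. Since every
-- prime path is an excursion, P *_λ Q unfolds to P' D^(L−t₁) Q₁ D^(t₁−t₂) Q₂ ⋯ Q_r D^(t_r):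
-- the only freedom is how many down steps precede each Qⱼ. If tⱼ ≤ sⱼ for all j, moving
-- each excursion Qⱼ to the left past sⱼ − tⱼ down steps, one covering move at a time, goes
-- from the λ-path to the γ-path. Conversely a covering move never lowers the starting
-- height of any up step, and the first up step of Qⱼ starts at height tⱼ.
module Submission where

open import Defs
open import Data.Nat using (ℕ; zero; suc; _+_; _∸_; _≤_; z≤n; s≤s)
open import Data.Nat.Properties
  using (≤-refl; ≤-trans; +-comm; +-assoc; +-suc; +-identityʳ; suc-injective; m≤n+m; +-monoˡ-≤;
         ∸-monoˡ-≤; m∸n≤m; ∸-+-assoc; +-∸-assoc; m+n∸n≡m; m∸n+n≡m; m∸[m∸n]≡n)
open import Data.Fin using (Fin)
open import Data.List using (List; []; _∷_; _++_; length; take; replicate; reverse)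
open import Data.List.Properties
  using (++-assoc; ++-identityʳ; length-++; length-replicate; take-all; reverse-++; reverse-involutive; unfold-reverse)
open import Data.List.Relation.Binary.Pointwise as List using ([]; _∷_; ++⁺ˡ; ++⁺ʳ; ++-cancelˡ)
import Data.List.Relation.Binary.Pointwise.Properties as List
open import Data.Vec using (Vec; []; _∷_; sum; lookup)
open import Data.Vec.Relation.Unary.All as All using (All; []; _∷_)
open import Data.Vec.Relation.Binary.Pointwise.Inductive as Vec using ([]; _∷_)
open import Data.Vec.Relation.Binary.Pointwise.Extensional
  using (ext; equivalent) renaming (Pointwise to PointwiseExt)
open import Data.Product using (Σ; _×_; _,_)
open import Data.Sum using (_⊎_; inj₁; inj₂)
open import Data.Empty using (⊥-elim)
open import Relation.Binary.PropositionalEquality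
  using (_≡_; refl; sym; trans; cong; cong₂; subst; subst₂; module ≡-Reasoning)
open import Relation.Binary.Construct.Closure.ReflexiveTransitive
  using (ε; _◅_; _◅◅_; gmap; fold)
open import Relation.Binary.Construct.Closure.ReflexiveTransitive.Properties using (module StarReasoning)
open import Function.Bundles using (_⇔_; mk⇔)
open import Function.Properties.Equivalence using () renaming (trans to ⇔-trans)

D^_ : ℕ → Path
D^ n = replicate n D

D^-+ : ∀ a b → D^ (a + b) ≡ D^ a ++ D^ b
D^-+ zero    b = refl
D^-+ (suc a) b = cong (D ∷_) (D^-+ a b)

D^-∸-split : ∀ {c s} → s ≤ c → D^ c ≡ D^ (c ∸ s) ++ D^ s
D^-∸-split {c} {s} s≤c = trans (cong D^_ (sym (m∸n+n≡m s≤c))) (D^-+ (c ∸ s) s)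

D^-telescope : ∀ {s t u} → s ≤ t → t ≤ u → D^ (u ∸ t) ++ D^ (t ∸ s) ≡ D^ (u ∸ s)
D^-telescope {s} {t} {u} s≤t t≤u = begin
  D^ (u ∸ t) ++ D^ (t ∸ s)  ≡⟨ sym (D^-+ (u ∸ t) (t ∸ s)) ⟩
  D^ ((u ∸ t) + (t ∸ s))    ≡⟨ cong D^_ (sym (+-∸-assoc (u ∸ t) s≤t)) ⟩
  D^ ((u ∸ t) + t ∸ s)      ≡⟨ cong (λ n → D^ (n ∸ s)) (m∸n+n≡m t≤u) ⟩
  D^ (u ∸ s)                ∎
  where open ≡-Reasoning

reverse-D^ : ∀ n → reverse (D^ n) ≡ D^ n
reverse-D^ zero    = refl
reverse-D^ (suc n) = begin
  reverse (D ∷ D^ n)     ≡⟨ unfold-reverse D (D^ n) ⟩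
  reverse (D^ n) ++ D^ 1 ≡⟨ cong (_++ D^ 1) (reverse-D^ n) ⟩
  D^ n ++ D^ 1           ≡⟨ sym (D^-+ n 1) ⟩
  D^ (n + 1)             ≡⟨ cong D^_ (+-comm n 1) ⟩
  D^ (suc n)             ∎
  where open ≡-Reasoning

take-length-++ : ∀ (A B : Path) → take (length A) (A ++ B) ≡ A
take-length-++ []      B = refl
take-length-++ (x ∷ A) B = cong (x ∷_) (take-length-++ A B)

×[0]≡++ : ∀ A B → A ×[ 0 ] B ≡ A ++ B
×[0]≡++ A B = cong₂ _++_ (take-all (length A) A ≤-refl) (++-identityʳ B)

×-trailing-D^ : ∀ A j Q → (A ++ D^ j) ×[ j ] Q ≡ A ++ Q ++ D^ j
×-trailing-D^ A j Q = begin
  take (length (A ++ D^ j) ∸ j) (A ++ D^ j) ++ Q ++ D^ j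
    ≡⟨ cong (λ n → take n (A ++ D^ j) ++ Q ++ D^ j) length-A ⟩
  take (length A) (A ++ D^ j) ++ Q ++ D^ j
    ≡⟨ cong (_++ Q ++ D^ j) (take-length-++ A (D^ j)) ⟩
  A ++ Q ++ D^ j ∎
  where
  open ≡-Reasoning
  length-A : length (A ++ D^ j) ∸ j ≡ length A
  length-A = begin
    length (A ++ D^ j) ∸ j         ≡⟨ cong (_∸ j) (length-++ A) ⟩
    length A + length (D^ j) ∸ j   ≡⟨ cong (λ n → length A + n ∸ j) (length-replicate j) ⟩
    length A + j ∸ j               ≡⟨ m+n∸n≡m (length A) j ⟩
    length A                       ∎

dropLeadingD : Path → Path
dropLeadingD (D ∷ xs) = dropLeadingD xs
dropLeadingD xs       = xs

D^-leadingD : ∀ xs → xs ≡ D^ (leadingD xs) ++ dropLeadingD xs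
D^-leadingD []       = refl
D^-leadingD (U ∷ xs) = refl
D^-leadingD (D ∷ xs) = cong (D ∷_) (D^-leadingD xs)

trunk : Path → Path
trunk P = reverse (dropLeadingD (reverse P))

trunk-++-D^L : ∀ P → P ≡ trunk P ++ D^ (L P)
trunk-++-D^L P = begin
  P                                                 ≡⟨ sym (reverse-involutive P) ⟩
  reverse (reverse P)                               ≡⟨ cong reverse (D^-leadingD (reverse P)) ⟩
  reverse (D^ (L P) ++ dropLeadingD (reverse P))    ≡⟨ reverse-++ (D^ (L P)) _ ⟩
  trunk P ++ reverse (D^ (L P))                     ≡⟨ cong (trunk P ++_) (reverse-D^ (L P)) ⟩
  trunk P ++ D^ (L P)                               ∎
  where open ≡-Reasoning

-- Heights are truncated at 0. Along a walk this never happens, and the monotonicity of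
-- upHeights under moves holds regardless.
heightAfter : ℕ → ℕ → Path → ℕ
heightAfter m k []       = k
heightAfter m k (U ∷ xs) = heightAfter m (k + m) xs
heightAfter m k (D ∷ xs) = heightAfter m (k ∸ 1) xs

upHeights : ℕ → ℕ → Path → List ℕ
upHeights m k []       = []
upHeights m k (U ∷ xs) = k ∷ upHeights m (k + m) xs
upHeights m k (D ∷ xs) = upHeights m (k ∸ 1) xs

upHeights-++ : ∀ m k xs ys →
  upHeights m k (xs ++ ys) ≡ upHeights m k xs ++ upHeights m (heightAfter m k xs) ys
upHeights-++ m k []       ys = refl
upHeights-++ m k (U ∷ xs) ys = cong (k ∷_) (upHeights-++ m (k + m) xs ys)
upHeights-++ m k (D ∷ xs) ys = upHeights-++ m (k ∸ 1) xs ys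

upHeights-D^-++ : ∀ m k n Z → upHeights m k (D^ n ++ Z) ≡ upHeights m (k ∸ n) Z
upHeights-D^-++ m k zero    Z = refl
upHeights-D^-++ m k (suc n) Z =
  trans (upHeights-D^-++ m (k ∸ 1) n Z) (cong (λ h → upHeights m h Z) (∸-+-assoc k 1 n))

length-upHeights : ∀ m a b xs → length (upHeights m a xs) ≡ length (upHeights m b xs)
length-upHeights m a b []       = refl
length-upHeights m a b (U ∷ xs) = cong suc (length-upHeights m (a + m) (b + m) xs)
length-upHeights m a b (D ∷ xs) = length-upHeights m (a ∸ 1) (b ∸ 1) xs

upHeights-mono : ∀ m {a b} xs → a ≤ b → List.Pointwise _≤_ (upHeights m a xs) (upHeights m b xs)
upHeights-mono m []       a≤b = []
upHeights-mono m (U ∷ xs) a≤b = a≤b ∷ upHeights-mono m xs (+-monoˡ-≤ m a≤b)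
upHeights-mono m (D ∷ xs) a≤b = upHeights-mono m xs (∸-monoˡ-≤ 1 a≤b)

walk-suffix : ∀ {m k} xs ys → Walk m k (xs ++ ys) → Walk m (heightAfter m k xs) ys
walk-suffix []       ys w       = w
walk-suffix (U ∷ xs) ys (w-U w) = walk-suffix xs ys w
walk-suffix (D ∷ xs) ys (w-D w) = walk-suffix xs ys w

walk-D^-height : ∀ {m k} n → Walk m k (D^ n) → k ≡ n
walk-D^-height zero    w-end   = refl
walk-D^-height (suc n) (w-D w) = cong suc (walk-D^-height n w)

Ret-heightAfter : ∀ {m j xs} → Ret m j xs → ∀ k → heightAfter m (k + j) xs ≡ k
Ret-heightAfter ret-end           k = +-identityʳ k
Ret-heightAfter (ret-D {j} r)     k rewrite +-suc k j = Ret-heightAfter r k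
Ret-heightAfter {m} (ret-U {j} r) k rewrite +-assoc k (suc j) m = Ret-heightAfter r k

excursion-heightAfter : ∀ {m E} → IsExcursion m E → ∀ k → heightAfter m k E ≡ k
excursion-heightAfter (xs , refl , r) k = Ret-heightAfter r k

upHeights-D^-excursion : ∀ {m c t q} X → t ≤ c → IsExcursion m q →
  upHeights m c (D^ (c ∸ t) ++ q ++ X) ≡ upHeights m t q ++ upHeights m t X
upHeights-D^-excursion {m} {c} {t} {q} X t≤c exc = begin
  upHeights m c (D^ (c ∸ t) ++ q ++ X)
    ≡⟨ upHeights-D^-++ m c (c ∸ t) (q ++ X) ⟩
  upHeights m (c ∸ (c ∸ t)) (q ++ X)
    ≡⟨ cong (λ k → upHeights m k (q ++ X)) (m∸[m∸n]≡n t≤c) ⟩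
  upHeights m t (q ++ X)
    ≡⟨ upHeights-++ m t q X ⟩
  upHeights m t q ++ upHeights m (heightAfter m t q) X
    ≡⟨ cong (λ k → upHeights m t q ++ upHeights m k X) (excursion-heightAfter exc t) ⟩
  upHeights m t q ++ upHeights m t X ∎
  where open ≡-Reasoning

-- A move lifts the up steps of E by one and leaves all others in place.
move-raises-upHeights : ∀ {m X Y} k → TamariStep m X Y →
  List.Pointwise _≤_ (upHeights m k X) (upHeights m k Y)
move-raises-upHeights {m} k (move A E B exc) =
  subst₂ (List.Pointwise _≤_) (sym before) (sym after)
    (++⁺ˡ ≤-refl (upHeights m k A) (++⁺ʳ ≤-refl (upHeights m (g ∸ 1) B)
      (upHeights-mono m E (m∸n≤m g 1))))
  where
  open ≡-Reasoning
  g : ℕ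
  g = heightAfter m k A
  before : upHeights m k (A ++ D ∷ E ++ B)
         ≡ upHeights m k A ++ upHeights m (g ∸ 1) E ++ upHeights m (g ∸ 1) B
  before = begin
    upHeights m k (A ++ D ∷ E ++ B)
      ≡⟨ upHeights-++ m k A (D ∷ E ++ B) ⟩
    upHeights m k A ++ upHeights m (g ∸ 1) (E ++ B)
      ≡⟨ cong (upHeights m k A ++_) (upHeights-++ m (g ∸ 1) E B) ⟩
    upHeights m k A ++ upHeights m (g ∸ 1) E ++ upHeights m (heightAfter m (g ∸ 1) E) B
      ≡⟨ cong (λ h → upHeights m k A ++ upHeights m (g ∸ 1) E ++ upHeights m h B)
              (excursion-heightAfter exc (g ∸ 1)) ⟩
    upHeights m k A ++ upHeights m (g ∸ 1) E ++ upHeights m (g ∸ 1) B ∎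
  after : upHeights m k (A ++ E ++ D ∷ B)
        ≡ upHeights m k A ++ upHeights m g E ++ upHeights m (g ∸ 1) B
  after = begin
    upHeights m k (A ++ E ++ D ∷ B)
      ≡⟨ upHeights-++ m k A (E ++ D ∷ B) ⟩
    upHeights m k A ++ upHeights m g (E ++ D ∷ B)
      ≡⟨ cong (upHeights m k A ++_) (upHeights-++ m g E (D ∷ B)) ⟩
    upHeights m k A ++ upHeights m g E ++ upHeights m (heightAfter m g E ∸ 1) B
      ≡⟨ cong (λ h → upHeights m k A ++ upHeights m g E ++ upHeights m (h ∸ 1) B)
              (excursion-heightAfter exc g) ⟩
    upHeights m k A ++ upHeights m g E ++ upHeights m (g ∸ 1) B ∎

≤T-raises-upHeights : ∀ {m X Y} k → X ≤T[ m ] Y →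
  List.Pointwise _≤_ (upHeights m k X) (upHeights m k Y)
≤T-raises-upHeights {m} k =
  fold (λ X Y → List.Pointwise _≤_ (upHeights m k X) (upHeights m k Y))
       (λ step → List.transitive ≤-trans (move-raises-upHeights k step))
       (List.refl ≤-refl)

walk-nonempty-size : ∀ {m x xs} → Walk m 0 (x ∷ xs) → 1 ≤ size (x ∷ xs)
walk-nonempty-size (w-U w) = s≤s z≤n

walk-first-return : ∀ {m j xs} → Walk m (suc j) xs →
  Ret m (suc j) xs ⊎ Σ Path λ ys → Σ Path λ zs → xs ≡ ys ++ zs × Walk m (suc j) ys × IsDyck m zs
walk-first-return (w-U w) with walk-first-return w
... | inj₁ r                           = inj₁ (ret-U r)
... | inj₂ (ys , zs , refl , wy , dz) = inj₂ (U ∷ ys , zs , refl , w-U wy , dz)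
walk-first-return {j = zero} (w-D {xs = []} w-end) = inj₁ (ret-D ret-end)
walk-first-return {j = zero} (w-D {xs = x ∷ xs} w) =
  inj₂ (D ∷ [] , x ∷ xs , refl , w-D w-end , w , walk-nonempty-size w)
walk-first-return {j = suc j} (w-D w) with walk-first-return w
... | inj₁ r                           = inj₁ (ret-D r)
... | inj₂ (ys , zs , refl , wy , dz) = inj₂ (D ∷ ys , zs , refl , w-D wy , dz)

prime⇒excursion : ∀ {m Q} → 1 ≤ m → IsPrime m Q → IsExcursion m Q
prime⇒excursion {suc m} {U ∷ xs} _ ((w-U w , _) , irreducible) with walk-first-return w
... | inj₁ r                           = xs , refl , r
... | inj₂ (ys , zs , refl , wy , dz) =
  ⊥-elim (irreducible (U ∷ ys , zs , (w-U wy , s≤s z≤n) , dz , sym (×[0]≡++ (U ∷ ys) zs)))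

data Descending (c : ℕ) : ∀ {k} → Vec ℕ k → Set where
  []  : Descending c []
  _∷_ : ∀ {t k} {ts : Vec ℕ k} → t ≤ c → Descending t ts → Descending c (t ∷ ts)

Descending-weaken : ∀ {c c' k} {ts : Vec ℕ k} → c ≤ c' → Descending c ts → Descending c' ts
Descending-weaken c≤c' []           = []
Descending-weaken c≤c' (t≤c ∷ desc) = ≤-trans t≤c c≤c' ∷ desc

tailSums-descending : ∀ {c k} (xs : Vec ℕ k) → sum xs ≤ c → Descending c (tailSums xs)
tailSums-descending []       _   = []
tailSums-descending (x ∷ xs) x+Σ≤c =
  x+Σ≤c ∷ tailSums-descending xs (m≤n+m (sum xs) x)

composition-tailSums-descending : ∀ {c k} x₀ (xs : Vec ℕ k) → sum (x₀ ∷ xs) ≡ c →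
  Descending c (tailSums xs)
composition-tailSums-descending x₀ xs refl = tailSums-descending xs (m≤n+m (sum xs) x₀)

spread : ∀ {k} → ℕ → Vec ℕ k → Vec Path k → Path
spread c []       []       = D^ c
spread c (t ∷ ts) (q ∷ qs) = D^ (c ∸ t) ++ q ++ spread t ts qs

starAux-spread : ∀ {c k} A {ts : Vec ℕ k} qs → Descending c ts →
  starAux (A ++ D^ c) ts qs ≡ A ++ spread c ts qs
starAux-spread A []       []                       = refl
starAux-spread {c} A {t ∷ ts} (q ∷ qs) (t≤c ∷ desc) = begin
  starAux ((A ++ D^ c) ×[ t ] q) ts qs
    ≡⟨ cong (λ B → starAux ((A ++ B) ×[ t ] q) ts qs) (D^-∸-split t≤c) ⟩
  starAux ((A ++ D^ (c ∸ t) ++ D^ t) ×[ t ] q) ts qs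
    ≡⟨ cong (λ B → starAux (B ×[ t ] q) ts qs) (sym (++-assoc A (D^ (c ∸ t)) (D^ t))) ⟩
  starAux (((A ++ D^ (c ∸ t)) ++ D^ t) ×[ t ] q) ts qs
    ≡⟨ cong (λ B → starAux B ts qs) (×-trailing-D^ (A ++ D^ (c ∸ t)) t q) ⟩
  starAux ((A ++ D^ (c ∸ t)) ++ q ++ D^ t) ts qs
    ≡⟨ cong (λ B → starAux B ts qs) (sym (++-assoc (A ++ D^ (c ∸ t)) q (D^ t))) ⟩
  starAux (((A ++ D^ (c ∸ t)) ++ q) ++ D^ t) ts qs
    ≡⟨ starAux-spread ((A ++ D^ (c ∸ t)) ++ q) qs desc ⟩
  ((A ++ D^ (c ∸ t)) ++ q) ++ spread t ts qs
    ≡⟨ ++-assoc (A ++ D^ (c ∸ t)) q _ ⟩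
  (A ++ D^ (c ∸ t)) ++ q ++ spread t ts qs
    ≡⟨ ++-assoc A (D^ (c ∸ t)) _ ⟩
  A ++ spread c (t ∷ ts) (q ∷ qs) ∎
  where open ≡-Reasoning

≤T-++ˡ : ∀ {m X Y} Z → X ≤T[ m ] Y → (Z ++ X) ≤T[ m ] (Z ++ Y)
≤T-++ˡ {m} Z = gmap (Z ++_) move-++ˡ
  where
  move-++ˡ : ∀ {X Y} → TamariStep m X Y → TamariStep m (Z ++ X) (Z ++ Y)
  move-++ˡ (move A E B exc) =
    subst₂ (TamariStep m) (++-assoc Z A _) (++-assoc Z A _) (move (Z ++ A) E B exc)

excursion-past-D^ : ∀ {m q} → IsExcursion m q → ∀ k X →
  (D^ k ++ q ++ X) ≤T[ m ] (q ++ D^ k ++ X)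
excursion-past-D^ exc zero    X = ε
excursion-past-D^ exc (suc k) X =
  ≤T-++ˡ (D^ 1) (excursion-past-D^ exc k X) ◅◅ move [] _ (D^ k ++ X) exc ◅ ε

D^-++-spread : ∀ {t u k} {ts : Vec ℕ k} qs → t ≤ u → Descending t ts →
  D^ (u ∸ t) ++ spread t ts qs ≡ spread u ts qs
D^-++-spread {t} {u} [] t≤u [] =
  trans (sym (D^-+ (u ∸ t) t)) (cong D^_ (m∸n+n≡m t≤u))
D^-++-spread {t} {u} {ts = s ∷ _} (q ∷ qs) t≤u (s≤t ∷ _) =
  trans (sym (++-assoc (D^ (u ∸ t)) (D^ (t ∸ s)) _))
        (cong (_++ q ++ _) (D^-telescope s≤t t≤u))

spread-≤T : ∀ {m c k} {ts us : Vec ℕ k} {qs} → All (IsExcursion m) qs →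
  Descending c ts → Descending c us → Vec.Pointwise _≤_ ts us →
  spread c ts qs ≤T[ m ] spread c us qs
spread-≤T [] [] [] [] = ε
spread-≤T {m} {c} {ts = t ∷ ts} {u ∷ us} {q ∷ qs}
  (exc ∷ excs) (t≤c ∷ desc-ts) (u≤c ∷ desc-us) (t≤u ∷ ts≤us) = begin
  D^ (c ∸ t) ++ q ++ spread t ts qs
    ≡⟨ cong (_++ q ++ spread t ts qs) (sym (D^-telescope t≤u u≤c)) ⟩
  (D^ (c ∸ u) ++ D^ (u ∸ t)) ++ q ++ spread t ts qs
    ≡⟨ ++-assoc (D^ (c ∸ u)) (D^ (u ∸ t)) _ ⟩
  D^ (c ∸ u) ++ D^ (u ∸ t) ++ q ++ spread t ts qs
    ⟶*⟨ ≤T-++ˡ (D^ (c ∸ u)) (excursion-past-D^ exc (u ∸ t) (spread t ts qs)) ⟩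
  D^ (c ∸ u) ++ q ++ D^ (u ∸ t) ++ spread t ts qs
    ≡⟨ cong (λ X → D^ (c ∸ u) ++ q ++ X) (D^-++-spread qs t≤u desc-ts) ⟩
  D^ (c ∸ u) ++ q ++ spread u ts qs
    ⟶*⟨ ≤T-++ˡ (D^ (c ∸ u)) (≤T-++ˡ q
          (spread-≤T excs (Descending-weaken t≤u desc-ts) desc-us ts≤us)) ⟩
  D^ (c ∸ u) ++ q ++ spread u us qs ∎
  where open StarReasoning (TamariStep m)

++-cancelˡ-length : ∀ {A : Set} {R : A → A → Set} {ws xs ys zs : List A} →
  length ws ≡ length xs → List.Pointwise R (ws ++ ys) (xs ++ zs) → List.Pointwise R ys zs
++-cancelˡ-length {ws = []}    {[]}    _   rs       = rs
++-cancelˡ-length {ws = _ ∷ _} {_ ∷ _} len (_ ∷ rs) = ++-cancelˡ-length (suc-injective len) rs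

-- The first up step of the excursion qⱼ starts at height tⱼ.
upHeights-spread-≤⇒≤ : ∀ {m c c' k} {ts us : Vec ℕ k} {qs} → All (IsExcursion m) qs →
  Descending c ts → Descending c' us →
  List.Pointwise _≤_ (upHeights m c (spread c ts qs)) (upHeights m c' (spread c' us qs)) →
  Vec.Pointwise _≤_ ts us
upHeights-spread-≤⇒≤ [] [] [] _ = []
upHeights-spread-≤⇒≤ {m} {ts = t ∷ ts} {u ∷ us} {q ∷ qs}
  (exc@(q' , refl , _) ∷ excs) (t≤c ∷ desc-ts) (u≤c' ∷ desc-us) heights≤
  with subst₂ (List.Pointwise _≤_)
         (upHeights-D^-excursion (spread t ts qs) t≤c exc)
         (upHeights-D^-excursion (spread u us qs) u≤c' exc) heights≤
... | t≤u ∷ rest≤ =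
  t≤u ∷ upHeights-spread-≤⇒≤ excs desc-ts desc-us
          (++-cancelˡ-length (length-upHeights m (t + m) (u + m) q') rest≤)

prefix-spread-≤T⇔≤ : ∀ {m c k} A {ts us : Vec ℕ k} {qs} → heightAfter m 0 A ≡ c →
  All (IsExcursion m) qs → Descending c ts → Descending c us →
  Vec.Pointwise _≤_ ts us ⇔ (A ++ spread c ts qs) ≤T[ m ] (A ++ spread c us qs)
prefix-spread-≤T⇔≤ {m} A refl excs desc-ts desc-us = mk⇔
  (λ ts≤us → ≤T-++ˡ A (spread-≤T excs desc-ts desc-us ts≤us))
  (λ A++ts≤A++us → upHeights-spread-≤⇒≤ excs desc-ts desc-us
    (++-cancelˡ (upHeights m 0 A)
      (subst₂ (List.Pointwise _≤_) (upHeights-++ m 0 A _) (upHeights-++ m 0 A _)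
        (≤T-raises-upHeights 0 A++ts≤A++us))))

trunk-height : ∀ {m P} → Walk m 0 P → heightAfter m 0 (trunk P) ≡ L P
trunk-height {m} {P} w =
  walk-D^-height (L P) (walk-suffix (trunk P) (D^ (L P)) (subst (Walk m 0) (trunk-++-D^L P) w))

star-trunk-spread : ∀ {k} P λ₀ (λs : Vec ℕ k) Qs → Descending (L P) (tailSums λs) →
  star P (λ₀ ∷ λs) Qs ≡ trunk P ++ spread (L P) (tailSums λs) Qs
star-trunk-spread P λ₀ λs Qs desc =
  trans (cong (λ A → starAux A (tailSums λs) Qs) (trunk-++-D^L P))
        (starAux-spread (trunk P) Qs desc)

lookup-≤⇔Pointwise : ∀ {k} {xs ys : Vec ℕ k} →
  (∀ j → lookup xs j ≤ lookup ys j) ⇔ Vec.Pointwise _≤_ xs ys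
lookup-≤⇔Pointwise = ⇔-trans (mk⇔ ext PointwiseExt.app) equivalent

lemma4p6 : (m : ℕ) → 1 ≤ m → (P : Path) → IsDyck m P →
    (r : ℕ) → (Qs : Vec Path (suc r)) → All (IsPrime m) Qs →
    (λ₀ γ₀ : ℕ) → (λs γs : Vec ℕ (suc r)) →
    sum (λ₀ ∷ λs) ≡ L P → sum (γ₀ ∷ γs) ≡ L P →
    ((∀ (j : Fin (suc r)) → lookup (tailSums λs) j ≤ lookup (tailSums γs) j)
    ⇔ (star P (λ₀ ∷ λs) Qs ≤T[ m ] star P (γ₀ ∷ γs) Qs))
lemma4p6 m 1≤m P (walk , _) r Qs primes λ₀ γ₀ λs γs Σλ≡L Σγ≡L =
  subst₂ (λ X Y → _ ⇔ X ≤T[ m ] Y)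
    (sym (star-trunk-spread P λ₀ λs Qs desc-λ)) (sym (star-trunk-spread P γ₀ γs Qs desc-γ))
    (⇔-trans lookup-≤⇔Pointwise
      (prefix-spread-≤T⇔≤ (trunk P) (trunk-height walk)
        (All.map (prime⇒excursion 1≤m) primes) desc-λ desc-γ))
  where
  desc-λ : Descending (L P) (tailSums λs)
  desc-λ = composition-tailSums-descending λ₀ λs Σλ≡L
  desc-γ : Descending (L P) (tailSums γs)
  desc-γ = composition-tailSums-descending γ₀ γs Σγ≡L
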